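{- Let $r,c,t$ be positive integers and let $T\in SSYT(r,c,t)$ be unmatched by $M$. Then every entry of $T$ with even value $2i<r+t-1$ has the value $2i+1$ immediately below it, and for each odd value $2i+1$ and each row of $T$, the number of copies of $2i+1$ in that row not having $2i$ immediately above them is even.
   Context: $SSYT(r,c,t)$ is the set of $r\times c$ arrays $T$ (rows $1,\dots,r$ top to bottom) with entries in $\{0,\dots,r+t-1\}$, weakly increasing along rows and strictly increasing down columns. For a row $R$ and value $i$, $(R,i)$ satisfies (1) if $i$ is odd, occurs in row $R$, and the number of occurrences of $i$ in row $R$ without $i-1$ immediately above (vacuous for row $1$) is odd; $(R,i)$ satisfies (2) if $i$ is even, $i<r+t-1$, $i$ occurs in row $R$, the rightmost occurrence of $i$ in row $R$ does not have $i+1$ immediately below it (vacuous for $R=r$), and the number of occurrences of $i+1$ in row $R$ without $i$ immediately above is even (possibly zero). $T$ is matched by $M$ if some $(R,i)$ satisfies (1) or (2) (then $M(T)$ changes one entry by $\pm1$); $T$ is unmatched if no $(R,i)$ satisfies (1) or (2). -}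

module Defs where

open import Data.Nat using (ℕ; zero; suc; _+_; _∸_; _≤_; _<_; _≡ᵇ_; _≤ᵇ_)
open import Data.Nat.Divisibility using (_∣_)
open import Data.Bool using (Bool; true; false; _∧_; _∨_; not)
open import Data.List using (List; filterᵇ; length; upTo; map)
open import Data.Product using (_×_; Σ; ∃; ∃-syntax; _,_)
open import Relation.Binary.PropositionalEquality using (_≡_; _≢_)
open import Relation.Nullary using (¬_)

-- A tableau is a function  T R j  giving the entry in row R, column j.
-- Rows are numbered 1..r (top to bottom), columns 1..c; values outside
-- this range are irrelevant.
Tableau : Set
Tableau = ℕ → ℕ → ℕ

cols : ℕ → List ℕ
cols c = map suc (upTo c)

record IsSSYT (r c t : ℕ) (T : Tableau) : Set where
  field
    entries  : ∀ R j → 1 ≤ R → R ≤ r → 1 ≤ j → j ≤ c → T R j < r + t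
    rowsWeak : ∀ R j → 1 ≤ R → R ≤ r → 1 ≤ j → j < c → T R j ≤ T R (suc j)
    colsStrict : ∀ R j → 1 ≤ R → R < r → 1 ≤ j → j ≤ c → T R j < T (suc R) j

-- number of columns j in 1..c with T R j = v such that the cell above
-- (row R-1) does not contain u; for R = 1 there is no cell above, so
-- every occurrence counts.
countNotAbove : Tableau → (c R v u : ℕ) → ℕ
countNotAbove T c R v u =
  length (filterᵇ (λ j → (T R j ≡ᵇ v) ∧ not ((2 ≤ᵇ R) ∧ (T (R ∸ 1) j ≡ᵇ u))) (cols c))

Even Odd : ℕ → Set
Even n = 2 ∣ n
Odd n = ¬ (2 ∣ n)

Occurs : (c : ℕ) → Tableau → (R i : ℕ) → Set
Occurs c T R i = ∃[ j ] (1 ≤ j × j ≤ c × T R j ≡ i)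

Cond1 : (r c t : ℕ) → Tableau → (R i : ℕ) → Set
Cond1 r c t T R i =
  Odd i × Occurs c T R i × Odd (countNotAbove T c R i (i ∸ 1))

Cond2 : (r c t : ℕ) → Tableau → (R i : ℕ) → Set
Cond2 r c t T R i =
  Even i × suc i < r + t × Occurs c T R i ×
  (∀ j → 1 ≤ j → j ≤ c → T R j ≡ i →
     (∀ j' → j < j' → j' ≤ c → T R j' ≢ i) →
     ¬ (R < r × T (suc R) j ≡ suc i)) ×
  Even (countNotAbove T c R (suc i) i)

Unmatched : (r c t : ℕ) → Tableau → Set
Unmatched r c t T =
  ∀ R i → 1 ≤ R → R ≤ r → ¬ Cond1 r c t T R i × ¬ Cond2 r c t T R i

-- In an unmatched tableau condition (1) never holds, and an odd count of an
-- odd value i in a row would in particular make i occur there; so all these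
-- counts are even. For an even entry i = T R j with i + 1 < r + t, take the
-- rightmost occurrence k ≥ j of i in row R. Condition (2) fails for (R, i)
-- although every other clause of it holds (the count of i + 1 is even by the
-- first part), so i + 1 lies below position k. Row R + 1 is weakly increasing
-- and strictly above row R columnwise, so i < T (R + 1) j ≤ T (R + 1) k = i + 1.
module Submission where

open import Defs
open import Data.Bool using (Bool; T; T?)
open import Data.Bool.Properties using (T-∧)
open import Data.Empty using (⊥-elim)
open import Data.List using ([]; _∷_; filterᵇ; length)
open import Data.List.Membership.Propositional using (_∈_)
open import Data.List.Membership.Propositional.Properties
  using (∈-filter⁻; ∈-map⁻; ∈-upTo⁻)
open import Data.List.Relation.Unary.Any using (here)
open import Data.Nat using (ℕ; zero; suc; _+_; _∸_; _≤_; _<_; z≤n; s≤s; s≤s⁻¹; _<?_; _≟_)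
open import Data.Nat.Divisibility using (_∣_; _∣?_; _∣0; >⇒∤; ∣m+n∣m⇒∣n)
open import Data.Nat.Properties
  using (≡ᵇ⇒≡; ≤-refl; ≤-trans; ≤-antisym; <⇒≱; <⇒≤; <-cmp; +-comm; m≤n⇒m<n∨m≡n; m≤n⇒m≤1+n)
open import Data.Product using (_×_; _,_; proj₁; proj₂; ∃-syntax)
open import Data.Sum using (inj₁; inj₂)
open import Function using (_∘_)
open import Function.Bundles using (Equivalence)
open import Relation.Binary using (tri<; tri≈; tri>)
open import Relation.Binary.PropositionalEquality using (_≡_; _≢_; refl; sym; subst)
open import Relation.Nullary using (¬_; yes; no; contradiction)
open import Relation.Nullary.Decidable using (_×-dec_; decidable-stable)
open import Relation.Unary using (Decidable)

¬Odd⇒Even : ∀ {n} → ¬ Odd n → Even n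
¬Odd⇒Even {n} = decidable-stable (2 ∣? n)

Even⇒Odd-suc : ∀ {n} → Even n → Odd (suc n)
Even⇒Odd-suc {n} 2∣n 2∣1+n =
  >⇒∤ (s≤s (s≤s z≤n)) (∣m+n∣m⇒∣n (subst (2 ∣_) (+-comm 1 n) 2∣1+n) 2∣n)

length-filterᵇ≢0⇒∃ : ∀ {A : Set} (p : A → Bool) xs →
  length (filterᵇ p xs) ≢ 0 → ∃[ x ] (x ∈ xs × T (p x))
length-filterᵇ≢0⇒∃ p xs len≢0 with filterᵇ p xs in eq
... | []    = ⊥-elim (len≢0 refl)
... | y ∷ _ = y , ∈-filter⁻ (T? ∘ p) (subst (y ∈_) (sym eq) (here refl))

∈-cols⁻ : ∀ {c j} → j ∈ cols c → 1 ≤ j × j ≤ c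
∈-cols⁻ j∈cols with ∈-map⁻ suc j∈cols
... | k , k∈upTo , refl = s≤s z≤n , ∈-upTo⁻ k∈upTo

countNotAbove≢0⇒Occurs : ∀ {T c R v u} → countNotAbove T c R v u ≢ 0 → Occurs c T R v
countNotAbove≢0⇒Occurs {T} {c} {R} {v} count≢0
  with j , j∈cols , counted ← length-filterᵇ≢0⇒∃ _ (cols c) count≢0
  = let 1≤j , j≤c = ∈-cols⁻ j∈cols
    in j , 1≤j , j≤c , ≡ᵇ⇒≡ (T R j) v (proj₁ (Equivalence.to T-∧ counted))

IsLast : (ℕ → Set) → ℕ → ℕ → Set
IsLast P c k = P k × (∀ k' → k < k' → k' ≤ c → ¬ P k')

last-exists : ∀ {P : ℕ → Set} → Decidable P → ∀ {j c} → P j → j ≤ c →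
  ∃[ k ] (j ≤ k × k ≤ c × IsLast P c k)
last-exists P? {c = zero} pj z≤n =
  0 , z≤n , z≤n , pj , λ _ 0<k' k'≤0 → contradiction k'≤0 (<⇒≱ 0<k')
last-exists {P} P? {c = suc c} pj j≤1+c with P? (suc c) | m≤n⇒m<n∨m≡n j≤1+c
... | yes pc  | _ =
  suc c , j≤1+c , ≤-refl , pc , λ _ c<k' k'≤c → contradiction k'≤c (<⇒≱ c<k')
... | no ¬pc  | inj₂ refl = contradiction pj ¬pc
... | no ¬pc  | inj₁ j<1+c
  with k , j≤k , k≤c , pk , after ← last-exists P? pj (s≤s⁻¹ j<1+c)
  = k , j≤k , m≤n⇒m≤1+n k≤c , pk , after′
  where
  after′ : ∀ k' → k < k' → k' ≤ suc c → ¬ P k'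
  after′ k' k<k' k'≤1+c with m≤n⇒m<n∨m≡n k'≤1+c
  ... | inj₁ k'<1+c = after k' k<k' (s≤s⁻¹ k'<1+c)
  ... | inj₂ refl   = ¬pc

last-unique : ∀ {P c k k'} → IsLast P c k → IsLast P c k' → k ≤ c → k' ≤ c → k ≡ k'
last-unique {k = k} {k'} (pk , afterk) (pk' , afterk') k≤c k'≤c with <-cmp k k'
... | tri< k<k' _ _ = contradiction pk' (afterk k' k<k' k'≤c)
... | tri≈ _ k≡k' _ = k≡k'
... | tri> _ _ k'<k = contradiction pk (afterk' k k'<k k≤c)

module _ {r c t : ℕ} {T : Tableau} (U : Unmatched r c t T) where

  odd-countNotAbove-even : ∀ {R i} → 1 ≤ R → R ≤ r → Odd i →
    Even (countNotAbove T c R i (i ∸ 1))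
  odd-countNotAbove-even {R} {i} 1≤R R≤r odd = ¬Odd⇒Even λ oddCount →
    let count≢0 = λ count≡0 → oddCount (subst (2 ∣_) (sym count≡0) (2 ∣0))
    in proj₁ (U R i 1≤R R≤r) (odd , countNotAbove≢0⇒Occurs {T} {u = i ∸ 1} count≢0 , oddCount)

  last-even-has-suc-below : ∀ {R i j} → 1 ≤ R → R ≤ r → Even i → suc i < r + t →
    1 ≤ j → j ≤ c → IsLast (λ k → T R k ≡ i) c j → R < r × T (suc R) j ≡ suc i
  last-even-has-suc-below {R} {i} {j} 1≤R R≤r even i+1<r+t 1≤j j≤c last
    with R <? r ×-dec T (suc R) j ≟ suc i
  ... | yes below = below
  ... | no ¬below = ⊥-elim (proj₂ (U R i 1≤R R≤r)
          (even , i+1<r+t , (j , 1≤j , j≤c , proj₁ last) , only-last-lacks ,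
           odd-countNotAbove-even 1≤R R≤r (Even⇒Odd-suc even)))
    where
    only-last-lacks : ∀ j' → 1 ≤ j' → j' ≤ c → T R j' ≡ i →
      (∀ j'' → j' < j'' → j'' ≤ c → T R j'' ≢ i) → ¬ (R < r × T (suc R) j' ≡ suc i)
    only-last-lacks j' _ j'≤c Tj'≡i after
      rewrite last-unique (Tj'≡i , after) last j'≤c j≤c = ¬below

module _ {r c t : ℕ} {T : Tableau} (S : IsSSYT r c t T) where
  open IsSSYT S

  row-mono : ∀ {R j j'} → 1 ≤ R → R ≤ r → 1 ≤ j → j ≤ j' → j' ≤ c → T R j ≤ T R j'
  row-mono {j' = zero} _ _ 1≤j j≤0 _ = contradiction (≤-trans 1≤j j≤0) λ ()
  row-mono {j' = suc j'} 1≤R R≤r 1≤j j≤1+j' 1+j'≤c with m≤n⇒m<n∨m≡n j≤1+j'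
  ... | inj₂ refl   = ≤-refl
  ... | inj₁ j<1+j' = ≤-trans (row-mono 1≤R R≤r 1≤j j≤j' (<⇒≤ 1+j'≤c))
                              (rowsWeak _ j' 1≤R R≤r (≤-trans 1≤j j≤j') 1+j'≤c)
    where
    j≤j' : _ ≤ j'
    j≤j' = s≤s⁻¹ j<1+j'

  module _ (U : Unmatched r c t T) where

    even-entry-has-suc-below : ∀ R j → 1 ≤ R → R ≤ r → 1 ≤ j → j ≤ c →
      Even (T R j) → suc (T R j) < r + t → R < r × T (suc R) j ≡ suc (T R j)
    even-entry-has-suc-below R j 1≤R R≤r 1≤j j≤c even i+1<r+t
      with k , j≤k , k≤c , last ← last-exists (λ k → T R k ≟ T R j) refl j≤c
      with R<r , below-k ← last-even-has-suc-below U 1≤R R≤r even i+1<r+t (≤-trans 1≤j j≤k) k≤c last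
      = R<r , ≤-antisym
          (subst (T (suc R) j ≤_) below-k (row-mono (s≤s z≤n) R<r 1≤j j≤k k≤c))
          (colsStrict R j 1≤R R<r 1≤j j≤c)

lemma5p5 : (r c t : ℕ) → 1 ≤ r → 1 ≤ c → 1 ≤ t → (T : Tableau) →
    IsSSYT r c t T → Unmatched r c t T →
    ((R j : ℕ) → 1 ≤ R → R ≤ r → 1 ≤ j → j ≤ c →
       Even (T R j) → suc (T R j) < r + t →
       R < r × T (suc R) j ≡ suc (T R j)) ×
    ((R i : ℕ) → 1 ≤ R → R ≤ r → Odd i →
       Even (countNotAbove T c R i (i ∸ 1)))
lemma5p5 r c t _ _ _ T S U =
  even-entry-has-suc-below S U , λ R i → odd-countNotAbove-even U
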